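{- A homomorphically full oriented graph has at most one nontrivial connected component (a component containing at least one arc).
   Context: An oriented graph is a finite simple loopless graph in which each edge is assigned a direction. A homomorphism of oriented graphs maps vertices to vertices so that arcs go to arcs; it is complete if surjective on vertices and on arcs. A homomorphic image of an oriented graph $G$ is an oriented graph $H$ with a complete homomorphism $G\to H$. $G$ is homomorphically full if every homomorphic image of $G$ is isomorphic to a subgraph of $G$. Components are those of the underlying undirected graph. -}

module Defs where

open import Data.Nat using (ℕ)
open import Data.Fin using (Fin)
open import Data.Bool using (Bool; true; false; _∧_)
open import Data.Product using (Σ; ∃; ∃-syntax; _×_; _,_)
open import Data.Sum using (_⊎_)
open import Relation.Binary.PropositionalEquality using (_≡_)
open import Relation.Binary.Construct.Closure.ReflexiveTransitive using (Star)
open import Function.Definitions using (Injective; Surjective)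

record OrientedGraph : Set where
  field
    size      : ℕ
    arc       : Fin size → Fin size → Bool
    loopless  : ∀ x → arc x x ≡ false
    oriented  : ∀ x y → arc x y ∧ arc y x ≡ false

open OrientedGraph public

Arc : (G : OrientedGraph) → Fin (size G) → Fin (size G) → Set
Arc G x y = arc G x y ≡ true

IsHom : (G H : OrientedGraph) → (Fin (size G) → Fin (size H)) → Set
IsHom G H f = ∀ x y → Arc G x y → Arc H (f x) (f y)

IsCompleteHom : (G H : OrientedGraph) → (Fin (size G) → Fin (size H)) → Set
IsCompleteHom G H f =
  IsHom G H f
  × Surjective _≡_ _≡_ f
  × (∀ u v → Arc H u v →
       ∃[ x ] ∃[ y ] (Arc G x y × f x ≡ u × f y ≡ v))

HomImage : (H G : OrientedGraph) → Set
HomImage H G = ∃[ f ] IsCompleteHom G H f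

-- H is isomorphic to a (not necessarily induced) subgraph of G:
-- there is an injective homomorphism H → G.
IsoToSubgraph : (H G : OrientedGraph) → Set
IsoToSubgraph H G = ∃[ g ] (Injective _≡_ _≡_ g × IsHom H G g)

HomFull : OrientedGraph → Set
HomFull G = ∀ (H : OrientedGraph) → HomImage H G → IsoToSubgraph H G

Adj : (G : OrientedGraph) → Fin (size G) → Fin (size G) → Set
Adj G x y = Arc G x y ⊎ Arc G y x

Connected : (G : OrientedGraph) → Fin (size G) → Fin (size G) → Set
Connected G = Star (Adj G)

AtMostOneNontrivialComponent : OrientedGraph → Set
AtMostOneNontrivialComponent G =
  ∀ a b c d → Arc G a b → Arc G c d → Connected G a c

-- For arcs ab and cd it suffices that b and c are at distance at most 2.
-- Otherwise identifying b with c yields a homomorphic image H that is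
-- injective on arcs. Embedding H back into G gives an endomorphism φ of G
-- which is injective on arcs, hence on the finite set of pairs of arcs sharing
-- an endpoint; but the pair (φ(ab), φ(cd)) shares the endpoint φ(b) = φ(c)
-- and has no preimage there, contradicting finiteness.
module Submission where

open import Data.Bool using (true; false; _∧_)
import Data.Bool.Properties as Bool
open import Data.Fin using (Fin; punchOut; punchIn; combine)
open import Data.Fin.Properties
  using (_≟_; any?; combine-injective; punchOut-cong; punchOut-injective;
         punchOut-punchIn; punchInᵢ≢i; ℕ→Fin-notInjective)
open import Data.Nat using (ℕ; zero; suc; pred; _*_)
open import Data.Nat.GeneralisedArithmetic using (fold)
open import Data.Product using (_×_; _,_; ∃-syntax; map; proj₁)
open import Data.Product.Properties using (,-injective)
open import Data.Sum using (_⊎_; inj₁; inj₂; swap)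
import Data.Sum as Sum
open import Function using (_∘_)
open import Function.Definitions using (Injective; Surjective)
open import Relation.Binary.Construct.Closure.ReflexiveTransitive using (ε; _◅_)
open import Relation.Binary.PropositionalEquality
  using (_≡_; _≢_; refl; sym; trans; cong; cong₂; subst)
open import Relation.Nullary using (Dec; yes; no; ¬_; does; proof; contradiction)
open import Relation.Nullary.Decidable
  using (_×-dec_; _⊎-dec_; dec-true; dec-false; decidable-stable)
open import Relation.Nullary.Reflects using (Reflects; invert)

open import Defs

-- The orbit of a missed point is an injection ℕ → Fin n.
injectiveOn⇒¬missesPoint :
  ∀ {A : Set} {n} {encode : A → Fin n} → Injective _≡_ _≡_ encode →
  (S : A → Set) (φ : A → A) →
  (∀ x → S x → S (φ x)) →
  (∀ x y → S x → S y → φ x ≡ φ y → x ≡ y) →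
  ∀ p → S p → ¬ (∀ x → S x → φ x ≢ p)
injectiveOn⇒¬missesPoint {encode = encode} encode-injective S φ φ-closed φ-injective p Sp missed =
  ℕ→Fin-notInjective (encode ∘ orbit) (orbit-injective ∘ encode-injective)
  where
  orbit : ℕ → _
  orbit = fold p φ

  orbit-in-S : ∀ k → S (orbit k)
  orbit-in-S zero    = Sp
  orbit-in-S (suc k) = φ-closed _ (orbit-in-S k)

  orbit-injective : Injective _≡_ _≡_ orbit
  orbit-injective {zero}  {zero}  _  = refl
  orbit-injective {zero}  {suc j} eq = contradiction (sym eq) (missed _ (orbit-in-S j))
  orbit-injective {suc i} {zero}  eq = contradiction eq (missed _ (orbit-in-S i))
  orbit-injective {suc i} {suc j} eq =
    cong suc (orbit-injective (φ-injective _ _ (orbit-in-S i) (orbit-in-S j) eq))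

does-true⇒ : ∀ {P : Set} (P? : Dec P) → does P? ≡ true → P
does-true⇒ P? eq = invert (subst (Reflects _) eq (proof P?))

Edge : ℕ → Set
Edge n = Fin n × Fin n

mapEdge : ∀ {A B : Set} → (A → B) → A × A → B × B
mapEdge F = map F F

mapEdgePair : ∀ {A B : Set} → (A → B) → (A × A) × (A × A) → (B × B) × (B × B)
mapEdgePair F = map (mapEdge F) (mapEdge F)

encodeEdgePair : ∀ {n} → Edge n × Edge n → Fin ((n * n) * (n * n))
encodeEdgePair ((x , y) , (x′ , y′)) = combine (combine x y) (combine x′ y′)

encodeEdgePair-injective : ∀ {n} → Injective _≡_ _≡_ (encodeEdgePair {n})
encodeEdgePair-injective {x = (x , y) , (x′ , y′)} {y = (u , v) , (u′ , v′)} eq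
  with e , e′ ← combine-injective (combine x y) (combine x′ y′) (combine u v) (combine u′ v′) eq
  with refl , refl ← combine-injective x y u v e
  with refl , refl ← combine-injective x′ y′ u′ v′ e′ = refl

Incident : ∀ {n} → Fin n → Edge n → Set
Incident u (x , y) = u ≡ x ⊎ u ≡ y

module _ (G : OrientedGraph) where

  IsArc : Edge (size G) → Set
  IsArc (x , y) = Arc G x y

  Touching : Edge (size G) × Edge (size G) → Set
  Touching (e , e′) = IsArc e × IsArc e′ × ∃[ u ] (Incident u e × Incident u e′)

  InjectiveOnArcs : ∀ {B : Set} → (Fin (size G) → B) → Set
  InjectiveOnArcs F = ∀ e e′ → IsArc e → IsArc e′ → mapEdge F e ≡ mapEdge F e′ → e ≡ e′

  Close : Fin (size G) → Fin (size G) → Set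
  Close x y = x ≡ y ⊎ Adj G x y ⊎ ∃[ z ] (Adj G z x × Adj G z y)

  arc? : ∀ x y → Dec (Arc G x y)
  arc? x y = arc G x y Bool.≟ true

  adj? : ∀ x y → Dec (Adj G x y)
  adj? x y = arc? x y ⊎-dec arc? y x

  close? : ∀ x y → Dec (Close x y)
  close? x y = x ≟ y ⊎-dec (adj? x y ⊎-dec any? λ z → adj? z x ×-dec adj? z y)

  close-sym : ∀ {x y} → Close x y → Close y x
  close-sym = Sum.map sym (Sum.map swap λ (z , zx , zy) → z , zy , zx)

  close⇒connected : ∀ {x y} → Close x y → Connected G x y
  close⇒connected (inj₁ refl)                  = ε
  close⇒connected (inj₂ (inj₁ xy))             = xy ◅ ε
  close⇒connected (inj₂ (inj₂ (z , zx , zy))) = swap zx ◅ zy ◅ ε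

  ¬loop : ∀ {x} → ¬ Arc G x x
  ¬loop {x} p with () ← trans (sym (loopless G x)) p

  ¬antiparallel : ∀ {x y} → Arc G x y → ¬ Arc G y x
  ¬antiparallel {x} {y} p q with () ← trans (sym (oriented G x y)) (cong₂ _∧_ p q)

  incident-arcs⇒close : ∀ {a b c d u} → Arc G a b → Arc G c d →
                        Incident u (a , b) → Incident u (c , d) → Close b c
  incident-arcs⇒close ab cd (inj₁ refl) (inj₁ refl) = inj₂ (inj₁ (inj₂ ab))
  incident-arcs⇒close ab cd (inj₁ refl) (inj₂ refl) = inj₂ (inj₂ (_ , inj₁ ab , inj₂ cd))
  incident-arcs⇒close ab cd (inj₂ refl) (inj₁ refl) = inj₁ refl
  incident-arcs⇒close ab cd (inj₂ refl) (inj₂ refl) = inj₂ (inj₁ (inj₂ cd))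

module _ {G H : OrientedGraph} {F : Fin (size G) → Fin (size H)} where

  hom-touching : IsHom G H F → ∀ t → Touching G t → Touching H (mapEdgePair F t)
  hom-touching hom ((x , y) , (x′ , y′)) (p , p′ , u , i , i′) =
    hom x y p , hom x′ y′ p′ , F u , Sum.map (cong F) (cong F) i , Sum.map (cong F) (cong F) i′

  injectiveOnArcs⇒touching-injective :
    InjectiveOnArcs G F → ∀ t t′ → Touching G t → Touching G t′ →
    mapEdgePair F t ≡ mapEdgePair F t′ → t ≡ t′
  injectiveOnArcs⇒touching-injective inj (e₁ , e₂) (e₁′ , e₂′) (p₁ , p₂ , _) (p₁′ , p₂′ , _) eq
    with eq₁ , eq₂ ← ,-injective eq =
    cong₂ _,_ (inj e₁ e₁′ p₁ p₁′ eq₁) (inj e₂ e₂′ p₂ p₂′ eq₂)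

injectiveOnArcs-∘ : ∀ {G : OrientedGraph} {B C : Set} {F : Fin (size G) → B} {g : B → C} →
                    Injective _≡_ _≡_ g → InjectiveOnArcs G F → InjectiveOnArcs G (g ∘ F)
injectiveOnArcs-∘ g-injective F-inj e e′ p p′ eq with eq₁ , eq₂ ← ,-injective eq =
  F-inj e e′ p p′ (cong₂ _,_ (g-injective eq₁) (g-injective eq₂))

module Image (G : OrientedGraph) {m : ℕ} (f : Fin (size G) → Fin m)
  (f-¬loop : ∀ {x y} → Arc G x y → f x ≢ f y)
  (f-¬antiparallel : ∀ {x y x′ y′} → Arc G x y → Arc G x′ y′ → f x ≡ f y′ → f y ≢ f x′)
  where

  ImageArc : Fin m → Fin m → Set
  ImageArc u v = ∃[ x ] ∃[ y ] (Arc G x y × f x ≡ u × f y ≡ v)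

  imageArc? : ∀ u v → Dec (ImageArc u v)
  imageArc? u v = any? λ x → any? λ y → arc? G x y ×-dec (f x ≟ u ×-dec f y ≟ v)

  image-loopless : ∀ u → does (imageArc? u u) ≡ false
  image-loopless u = dec-false (imageArc? u u) λ (x , y , p , fx , fy) → f-¬loop p (trans fx (sym fy))

  image-oriented : ∀ u v → does (imageArc? u v) ∧ does (imageArc? v u) ≡ false
  image-oriented u v with imageArc? u v | imageArc? v u
  ... | yes (x , y , p , fx , fy) | yes (x′ , y′ , p′ , fx′ , fy′) =
    contradiction (trans fy (sym fx′)) (f-¬antiparallel p p′ (trans fx (sym fy′)))
  ... | yes _ | no _ = refl
  ... | no _  | _    = refl

  image : OrientedGraph
  image = record
    { size     = m
    ; arc      = λ u v → does (imageArc? u v)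
    ; loopless = image-loopless
    ; oriented = image-oriented
    }

  image-complete : Surjective _≡_ _≡_ f → IsCompleteHom G image f
  image-complete f-surjective =
    (λ x y p → dec-true (imageArc? (f x) (f y)) (x , y , p , refl , refl)) ,
    f-surjective ,
    λ u v → does-true⇒ (imageArc? u v)

Merged : ∀ {n} → Fin n → Fin n → Fin n → Fin n → Set
Merged b c x y = (x ≡ b × y ≡ c) ⊎ (x ≡ c × y ≡ b)

-- Sends c to the position of b and closes the gap left by c.
contract : ∀ {n} {b c : Fin n} → b ≢ c → Fin n → Fin (pred n)
contract {zero}  {()}
contract {suc _} {b} {c} b≢c x with x ≟ c
... | yes _   = punchOut {i = c} {j = b} (b≢c ∘ sym)
... | no  x≢c = punchOut {i = c} {j = x} (x≢c ∘ sym)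

contract-identifies : ∀ {n} {b c : Fin n} (b≢c : b ≢ c) → contract b≢c b ≡ contract b≢c c
contract-identifies {suc _} {b} {c} b≢c with b ≟ c | c ≟ c
... | yes b≡c | _       = contradiction b≡c b≢c
... | no  _   | no  c≢c = contradiction refl c≢c
... | no  _   | yes _   = punchOut-cong c refl

contract-fibre : ∀ {n} {b c : Fin n} (b≢c : b ≢ c) {x y} →
                 contract b≢c x ≡ contract b≢c y → x ≡ y ⊎ Merged b c x y
contract-fibre {suc _} {b} {c} b≢c {x} {y} eq with x ≟ c | y ≟ c
... | yes refl | yes refl = inj₁ refl
... | yes refl | no  y≢c = inj₂ (inj₂ (refl , sym (punchOut-injective (b≢c ∘ sym) (y≢c ∘ sym) eq)))
... | no  x≢c | yes refl = inj₂ (inj₁ (punchOut-injective (x≢c ∘ sym) (b≢c ∘ sym) eq , refl))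
... | no  x≢c | no  y≢c = inj₁ (punchOut-injective (x≢c ∘ sym) (y≢c ∘ sym) eq)

contract-surjective : ∀ {n} {b c : Fin n} (b≢c : b ≢ c) → Surjective _≡_ _≡_ (contract b≢c)
contract-surjective {suc _} {b} {c} b≢c y = punchIn c y , λ { refl → contract-punchIn }
  where
  contract-punchIn : contract b≢c (punchIn c y) ≡ y
  contract-punchIn with punchIn c y ≟ c
  ... | yes eq = contradiction eq (punchInᵢ≢i c y)
  ... | no  _  = trans (punchOut-cong c refl) (punchOut-punchIn c)

module FarContraction {G : OrientedGraph} {b c : Fin (size G)} (far : ¬ Close G b c) where

  b≢c : b ≢ c
  b≢c = far ∘ inj₁

  f : Fin (size G) → Fin (pred (size G))
  f = contract b≢c

  merged-¬close : ∀ {x y} → Merged b c x y → ¬ Close G x y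
  merged-¬close (inj₁ (refl , refl)) = far
  merged-¬close (inj₂ (refl , refl)) = far ∘ close-sym G

  merged-¬arc : ∀ {x x′ y y′} → Merged b c x x′ → Merged b c y y′ → ¬ Arc G x y
  merged-¬arc (inj₁ (refl , refl)) (inj₁ (refl , refl)) = ¬loop G
  merged-¬arc (inj₁ (refl , refl)) (inj₂ (refl , refl)) = far ∘ inj₂ ∘ inj₁ ∘ inj₁
  merged-¬arc (inj₂ (refl , refl)) (inj₁ (refl , refl)) = far ∘ inj₂ ∘ inj₁ ∘ inj₂
  merged-¬arc (inj₂ (refl , refl)) (inj₂ (refl , refl)) = ¬loop G

  f-¬loop : ∀ {x y} → Arc G x y → f x ≢ f y
  f-¬loop p eq with contract-fibre b≢c eq
  ... | inj₁ refl = ¬loop G p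
  ... | inj₂ m    = merged-¬close m (inj₂ (inj₁ (inj₁ p)))

  f-¬antiparallel : ∀ {x y x′ y′} → Arc G x y → Arc G x′ y′ → f x ≡ f y′ → f y ≢ f x′
  f-¬antiparallel {x} {y} p p′ eq eq′ with contract-fibre b≢c eq | contract-fibre b≢c eq′
  ... | inj₁ refl | inj₁ refl = ¬antiparallel G p p′
  ... | inj₁ refl | inj₂ m    = merged-¬close m (inj₂ (inj₂ (x , inj₁ p , inj₂ p′)))
  ... | inj₂ m    | inj₁ refl = merged-¬close m (inj₂ (inj₂ (y , inj₂ p , inj₁ p′)))
  ... | inj₂ m    | inj₂ m′   = merged-¬arc m m′ p

  f-injectiveOnArcs : InjectiveOnArcs G f
  f-injectiveOnArcs (x , y) (x′ , y′) p p′ eq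
    with eq₁ , eq₂ ← ,-injective eq
    with contract-fibre b≢c eq₁ | contract-fibre b≢c eq₂
  ... | inj₁ refl | inj₁ refl = refl
  ... | inj₁ refl | inj₂ m    = contradiction (inj₂ (inj₂ (x , inj₁ p , inj₁ p′))) (merged-¬close m)
  ... | inj₂ m    | inj₁ refl = contradiction (inj₂ (inj₂ (y , inj₂ p , inj₂ p′))) (merged-¬close m)
  ... | inj₂ m    | inj₂ m′   = contradiction p (merged-¬arc m m′)

  open Image G f f-¬loop f-¬antiparallel

  f-complete : IsCompleteHom G image f
  f-complete = image-complete (contract-surjective b≢c)

  ¬homFull : ∀ {a d} → Arc G a b → Arc G c d → ¬ HomFull G
  ¬homFull {a} {d} ab cd full
    with g , g-injective , g-hom ← full image (f , f-complete) =
    injectiveOn⇒¬missesPoint encodeEdgePair-injective (Touching G) (mapEdgePair φ)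
      (hom-touching {G} {G} φ-hom) (injectiveOnArcs⇒touching-injective {G} {G} φ-injectiveOnArcs)
      (mapEdgePair φ ((a , b) , (c , d))) p₀-touching p₀-missed
    where
    φ : Fin (size G) → Fin (size G)
    φ = g ∘ f

    φ-hom : IsHom G G φ
    φ-hom x y = g-hom (f x) (f y) ∘ proj₁ f-complete x y

    φ-injectiveOnArcs : InjectiveOnArcs G φ
    φ-injectiveOnArcs = injectiveOnArcs-∘ {G = G} g-injective f-injectiveOnArcs

    p₀-touching : Touching G (mapEdgePair φ ((a , b) , (c , d)))
    p₀-touching = φ-hom a b ab , φ-hom c d cd , φ b , inj₂ refl , inj₁ (cong g (contract-identifies b≢c))

    p₀-missed : ∀ t → Touching G t → mapEdgePair φ t ≢ mapEdgePair φ ((a , b) , (c , d))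
    p₀-missed (e , e′) (p , p′ , u , i , i′) eq
      with eq₁ , eq₂ ← ,-injective eq
      with refl ← φ-injectiveOnArcs e (a , b) p ab eq₁
      with refl ← φ-injectiveOnArcs e′ (c , d) p′ cd eq₂ = far (incident-arcs⇒close G ab cd i i′)

homFull⇒arcs-close : ∀ G → HomFull G → ∀ {a b c d} → Arc G a b → Arc G c d → Close G b c
homFull⇒arcs-close G full {a} {b} {c} {d} ab cd =
  decidable-stable (close? G b c) λ far → FarContraction.¬homFull {G} {b} {c} far {a} {d} ab cd full

corollary9 : (G : OrientedGraph) → HomFull G → AtMostOneNontrivialComponent G
corollary9 G full a b c d ab cd = inj₁ ab ◅ close⇒connected G (homFull⇒arcs-close G full ab cd)
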